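{- Let $n\ge2$ and let $\langle c^m,c^M\rangle$ be a cell of size $n$. Let $c$ be any $(n-1)$-tuple such that $c_i\in\{c^m_i,c^M_i\}$ for every $i\in[n-1]$. Then $c$ is a cubic coordinate.
   Context: Tamari diagram of size $n$: a word $u=u_1\cdots u_n$ of integers with $0\le u_i\le n-i$ and $u_{i+j}\le u_i-j$ for all $i\in[n]$, $0\le j\le u_i$. Dual Tamari diagram of size $n$: a word $v=v_1\cdots v_n$ of integers with $0\le v_i\le i-1$ and $v_{i-j}\le v_i-j$ for all $i\in[n]$, $0\le j\le v_i$. A pair $(u,v)$ of these is a Tamari interval diagram if for all $1\le i<j\le n$ with $j-i\le u_i$ one has $v_j<j-i$. An $(n-1)$-tuple $c$ of integers is a cubic coordinate of size $n$ if the pair $(u,v)$ with $u_i=\max(c_i,0)$ ($i\in[n-1]$), $u_n=0$, $v_1=0$, $v_i=|\min(c_{i-1},0)|$ ($2\le i\le n$) is a Tamari interval diagram; $\mathcal{CC}_n$ is their set, ordered componentwise with covering relation $\lessdot$. For $c\in\mathcal{CC}_n$ and $i\in[n-1]$, $\uparrow_i(c)$ is defined when there exists $c'\in\mathcal{CC}_n$ with $c'_i>c_i$ and $c'_j=c_j$ for $j\ne i$; then $\uparrow_i(c)$ equals $c$ except that its $i$-th entry is the smallest integer $\widehat c_i>c_i$ for which the resulting tuple lies in $\mathcal{CC}_n$. A cubic coordinate $c$ is minimal-cellular if $\uparrow_i(c)$ is defined for all $i\in[n-1]$; its maximal-cellular correspondent is $\uparrow_1(\uparrow_2(\cdots(\uparrow_{n-1}(c))\cdots))$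 (always well defined). A cell $\langle c^m,c^M\rangle$ of size $n$ consists of a minimal-cellular $c^m$ of size $n$ and its maximal-cellular correspondent $c^M$. -}

module Defs where

open import Data.Nat using (ℕ; zero; suc; _∸_; _+_) renaming (_≤_ to _≤ℕ_; _<_ to _<ℕ_)
open import Data.Integer using (ℤ; +_; ∣_∣; _⊔_; _⊓_; _<_)
open import Data.Vec using (Vec; []; _∷_)
open import Data.Product using (Σ; _×_; ∃)
open import Relation.Binary.PropositionalEquality using (_≡_)
open import Relation.Nullary using (¬_)

-- Conventions: words and tuples are indexed from 1 (as in the paper).
-- A word of size n is a function ℕ → ℕ of which only positions 1..n matter.

-- 1-indexed lookup in an integer tuple; positions outside 1..k read as 0.
at : {k : ℕ} → Vec ℤ k → ℕ → ℤ
at [] _ = + 0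
at (x ∷ xs) zero = + 0
at (x ∷ xs) (suc zero) = x
at (x ∷ xs) (suc (suc i)) = at xs (suc i)

set : {k : ℕ} → Vec ℤ k → ℕ → ℤ → Vec ℤ k
set [] _ _ = []
set (x ∷ xs) zero y = x ∷ xs
set (x ∷ xs) (suc zero) y = y ∷ xs
set (x ∷ xs) (suc (suc i)) y = x ∷ set xs (suc i) y

TamariDiagram : ℕ → (ℕ → ℕ) → Set
TamariDiagram n u =
  (i : ℕ) → 1 ≤ℕ i → i ≤ℕ n →
    (u i ≤ℕ n ∸ i) × ((j : ℕ) → j ≤ℕ u i → u (i + j) ≤ℕ u i ∸ j)

-- Dual Tamari diagram of size n   (v_{i-j} ≤ v_i - j written as v_{i-j} + j ≤ v_i)
DualTamariDiagram : ℕ → (ℕ → ℕ) → Set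
DualTamariDiagram n v =
  (i : ℕ) → 1 ≤ℕ i → i ≤ℕ n →
    (v i ≤ℕ i ∸ 1) × ((j : ℕ) → j ≤ℕ v i → v (i ∸ j) + j ≤ℕ v i)

TamariIntervalDiagram : ℕ → (ℕ → ℕ) → (ℕ → ℕ) → Set
TamariIntervalDiagram n u v =
  TamariDiagram n u × DualTamariDiagram n v ×
  ((i j : ℕ) → 1 ≤ℕ i → i <ℕ j → j ≤ℕ n → j ∸ i ≤ℕ u i → v j <ℕ j ∸ i)

-- The pair (u,v) attached to an (n-1)-tuple c:
-- u_i = max(c_i,0) for i ∈ [n-1], u_n = 0; v_1 = 0, v_i = |min(c_{i-1},0)|.
uOf : {k : ℕ} → Vec ℤ k → ℕ → ℕ
uOf c i = ∣ at c i ⊔ + 0 ∣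

vOf : {k : ℕ} → Vec ℤ k → ℕ → ℕ
vOf c i = ∣ at c (i ∸ 1) ⊓ + 0 ∣

CubicCoordinate : (n : ℕ) → Vec ℤ (n ∸ 1) → Set
CubicCoordinate n c = TamariIntervalDiagram n (uOf c) (vOf c)

-- Up n i c d  :  ↑_i(c) is defined and equals d.
Up : (n : ℕ) → ℕ → Vec ℤ (n ∸ 1) → Vec ℤ (n ∸ 1) → Set
Up n i c d = Σ ℤ λ x →
  (d ≡ set c i x) × CubicCoordinate n d × (at c i < x) ×
  ((y : ℤ) → at c i < y → y < x → ¬ CubicCoordinate n (set c i y))

UpDefined : (n : ℕ) → ℕ → Vec ℤ (n ∸ 1) → Set
UpDefined n i c = Σ ℤ λ x → (at c i < x) × CubicCoordinate n (set c i x)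

MinimalCellular : (n : ℕ) → Vec ℤ (n ∸ 1) → Set
MinimalCellular n c =
  CubicCoordinate n c × ((i : ℕ) → 1 ≤ℕ i → i ≤ℕ n ∸ 1 → UpDefined n i c)

-- Ups n k c d : d = ↑_1(↑_2(⋯(↑_k(c))⋯))
Ups : (n : ℕ) → ℕ → Vec ℤ (n ∸ 1) → Vec ℤ (n ∸ 1) → Set
Ups n zero c d = d ≡ c
Ups n (suc k) c d = Σ (Vec ℤ (n ∸ 1)) λ e → Up n (suc k) c e × Ups n k e d

Cell : (n : ℕ) → Vec ℤ (n ∸ 1) → Vec ℤ (n ∸ 1) → Set
Cell n cm cM = MinimalCellular n cm × Ups n (n ∸ 1) cm cM

module Submission where

-- 1. Being a cubic coordinate is a local property of the entries f 1 … f (n-1)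
--    of a tuple: each entry obeys two bounds, and each pair of entries
--    f a, f (a+d) obeys three compatibility clauses (records Compatible and
--    Valid, with the bridges cubic⇒valid and valid⇒cubic).  Hence a mixture
--    of c^m and c^M is valid once all mixed pairs are compatible.
-- 2. The chain c^M = ↑_1(⋯(↑_{n-1}(c^m))⋯) raises one entry at a time, so its
--    members are the splices "c^m before position a, c^M from a on".  Each
--    step yields StepFacts: both neighbouring splices are valid and no value
--    strictly between c^m_a and c^M_a is admissible at position a.
-- 3. A mixed pair (c^m_a, c^M_{a+d}) occurs in the splice at a+d.  For a pair
--    (c^M_a, c^m_{a+d}) only the interval clause is not inherited from c^m
--    and c^M; it is proved by strong induction on d: if it failed, the value
--    d itself would be an admissible intermediate value at position a, which
--    the minimal-cellularity of c^m and the minimality of ↑_a rule out.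

open import Defs
open import Data.Nat using (ℕ; zero; suc; _∸_; _+_; z≤n; s≤s; _≤?_; _<?_; _≟_)
  renaming (_≤_ to _≤ℕ_; _<_ to _<ℕ_)
open import Data.Nat.Properties
open import Data.Nat.Induction using (<-rec)
open import Data.Integer using (ℤ; +_; -[1+_]; ∣_∣; _⊔_; _⊓_; _<_; -<-; -<+; +<+)
open import Data.Vec using (Vec; []; _∷_)
open import Data.Product using (Σ; _×_; _,_; proj₁; proj₂)
open import Data.Sum using (_⊎_; inj₁; inj₂; [_,_])
open import Data.Empty using (⊥-elim)
open import Function using (_∘_)
open import Relation.Binary.PropositionalEquality
  using (_≡_; _≢_; _≗_; refl; sym; trans; cong; subst; subst₂)
open import Relation.Nullary using (¬_; Dec; yes; no)

-- Positive and negative parts: u_i = pos c_i and v_{i+1} = neg c_i.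

pos : ℤ → ℕ
pos x = ∣ x ⊔ + 0 ∣

neg : ℤ → ℕ
neg x = ∣ x ⊓ + 0 ∣

pos-+ : ∀ k → pos (+ k) ≡ k
pos-+ = ⊔-identityʳ

neg-+ : ∀ k → neg (+ k) ≡ 0
neg-+ = ⊓-zeroʳ

pos⇒neg≡0 : ∀ x → 1 ≤ℕ pos x → neg x ≡ 0
pos⇒neg≡0 (+ k) _ = neg-+ k
pos⇒neg≡0 -[1+ k ] ()

pos-mono : ∀ {x y} → x < y → pos x ≤ℕ pos y
pos-mono (-<- _) = z≤n
pos-mono -<+ = z≤n
pos-mono (+<+ {m = a} {n = b} a<b) rewrite pos-+ a | pos-+ b = <⇒≤ a<b

neg-anti : ∀ {x y} → x < y → neg y ≤ℕ neg x
neg-anti (-<- n<m) = s≤s (<⇒≤ n<m)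
neg-anti (-<+ {n = k}) rewrite neg-+ k = z≤n
neg-anti (+<+ {m = a} {n = b} _) rewrite neg-+ a | neg-+ b = z≤n

<-below-pos : ∀ {x y} d → x < y → pos y ≤ℕ d → x < + d
<-below-pos d (-<- _) _ = -<+
<-below-pos d -<+ _ = -<+
<-below-pos d (+<+ {n = k} a<k) k≤d rewrite pos-+ k = +<+ (<-≤-trans a<k k≤d)

pos-above : ∀ {x} d → suc d ≤ℕ pos x → + d < x
pos-above {+ k} d d<k rewrite pos-+ k = +<+ d<k
pos-above { -[1+ k ]} d ()

negative : ∀ {x} → 1 ≤ℕ neg x → x < + 0
negative {+ k} 1≤neg = ⊥-elim (n≮0 (subst (1 ≤ℕ_) (neg-+ k) 1≤neg))
negative { -[1+ k ]} _ = -<+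

positive : ∀ {x} → 1 ≤ℕ pos x → + 0 < x
positive {+ k} 1≤pos rewrite pos-+ k = +<+ 1≤pos
positive { -[1+ k ]} ()

-- The clauses linking the entries x = c_a and y = c_{a+d} (d ≥ 1): the Tamari
-- condition at a, the dual Tamari condition at a+d+1, and the interval condition.
record Compatible (x y : ℤ) (d : ℕ) : Set where
  field
    tamari   : d ≤ℕ pos x → pos y + d ≤ℕ pos x
    dual     : d ≤ℕ neg y → neg x + d ≤ℕ neg y
    interval : suc d ≤ℕ pos x → neg y ≤ℕ d
open Compatible

compatible-≡ : ∀ {x x' y y' d} → x' ≡ x → y' ≡ y → Compatible x y d → Compatible x' y' d
compatible-≡ refl refl c = c

compatible-nonneg-right : ∀ {x k d} → 1 ≤ℕ d → (d ≤ℕ pos x → k + d ≤ℕ pos x) →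
  Compatible x (+ k) d
compatible-nonneg-right {x} {k} {d} 1≤d tam = record
  { tamari   = λ h → subst (λ z → z + d ≤ℕ pos x) (sym (pos-+ k)) (tam h)
  ; dual     = λ h → ⊥-elim (n≮0 (≤-trans 1≤d (subst (d ≤ℕ_) (neg-+ k) h)))
  ; interval = λ _ → subst (_≤ℕ d) (sym (neg-+ k)) z≤n
  }

compatible-nonneg-left : ∀ {k y d} → (d ≤ℕ k → pos y + d ≤ℕ k) →
  (suc d ≤ℕ k → neg y ≤ℕ d) → Compatible (+ k) y d
compatible-nonneg-left {k} {y} {d} tam int = record
  { tamari   = λ h → subst (pos y + d ≤ℕ_) (sym (pos-+ k)) (tam (subst (d ≤ℕ_) (pos-+ k) h))
  ; dual     = λ h → subst (λ z → z + d ≤ℕ neg y) (sym (neg-+ k)) h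
  ; interval = λ h → int (subst (suc d ≤ℕ_) (pos-+ k) h)
  }

record Valid (n : ℕ) (f : ℕ → ℤ) : Set where
  field
    pos-bound : ∀ i → 1 ≤ℕ i → i ≤ℕ n ∸ 1 → pos (f i) + i ≤ℕ n
    neg-bound : ∀ i → 1 ≤ℕ i → i ≤ℕ n ∸ 1 → neg (f i) ≤ℕ i
    pairs     : ∀ a d → 1 ≤ℕ a → 1 ≤ℕ d → a + d ≤ℕ n ∸ 1 → Compatible (f a) (f (a + d)) d
open Valid

Valid-cong : ∀ {n f g} → f ≗ g → Valid n f → Valid n g
Valid-cong {n} f≗g V = record
  { pos-bound = λ i p q → subst (λ z → pos z + i ≤ℕ n) (f≗g i) (pos-bound V i p q)
  ; neg-bound = λ i p q → subst (λ z → neg z ≤ℕ i) (f≗g i) (neg-bound V i p q)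
  ; pairs     = λ a d p q r → compatible-≡ (sym (f≗g a)) (sym (f≗g (a + d))) (pairs V a d p q r)
  }

in-range⇒< : ∀ {i n} → 1 ≤ℕ i → i ≤ℕ n ∸ 1 → i <ℕ n
in-range⇒< {n = zero} (s≤s z≤n) ()
in-range⇒< {n = suc n} _ i≤n = s≤s i≤n

update : (ℕ → ℤ) → ℕ → ℤ → ℕ → ℤ
update f a y j with j ≟ a
... | yes _ = y
... | no  _ = f j

update-eq : ∀ f a y → update f a y a ≡ y
update-eq f a y with a ≟ a
... | yes _ = refl
... | no a≢a = ⊥-elim (a≢a refl)

update-neq : ∀ f a y j → j ≢ a → update f a y j ≡ f j
update-neq f a y j j≢a with j ≟ a
... | yes j≡a = ⊥-elim (j≢a j≡a)
... | no  _ = refl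

update-cong : ∀ {f g} a y → f ≗ g → update f a y ≗ update g a y
update-cong a y f≗g j with j ≟ a
... | yes _ = refl
... | no  _ = f≗g j

splice : (ℕ → ℤ) → (ℕ → ℤ) → ℕ → ℕ → ℤ
splice m M k j with j <? k
... | yes _ = m j
... | no  _ = M j

splice-< : ∀ m M k j → j <ℕ k → splice m M k j ≡ m j
splice-< m M k j j<k with j <? k
... | yes _ = refl
... | no j≮k = ⊥-elim (j≮k j<k)

splice-≥ : ∀ m M k j → k ≤ℕ j → splice m M k j ≡ M j
splice-≥ m M k j k≤j with j <? k
... | yes j<k = ⊥-elim (<⇒≱ j<k k≤j)
... | no  _ = refl

splice-cong : ∀ {m m'} M k → (∀ j → j <ℕ k → m j ≡ m' j) → splice m M k ≗ splice m' M k
splice-cong M k agree j with j <? k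
... | yes j<k = agree j j<k
... | no  _ = refl

splice-at-1 : ∀ {m M} → m 0 ≡ M 0 → splice m M 1 ≗ M
splice-at-1 {m} {M} m0≡M0 zero = trans (splice-< m M 1 0 (s≤s z≤n)) m0≡M0
splice-at-1 {m} {M} _ (suc j) = splice-≥ m M 1 (suc j) (s≤s z≤n)

a+d≢a : ∀ a d → 1 ≤ℕ d → a + d ≢ a
a+d≢a a d 1≤d a+d≡a = <-irrefl (sym a+d≡a) (m<m+n a 1≤d)

at-zero : ∀ {k} (v : Vec ℤ k) → at v 0 ≡ + 0
at-zero [] = refl
at-zero (_ ∷ _) = refl

at-beyond : ∀ {k} (v : Vec ℤ k) j → k <ℕ j → at v j ≡ + 0
at-beyond [] j _ = refl
at-beyond (_ ∷ v) (suc zero) (s≤s ())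
at-beyond (_ ∷ v) (suc (suc j)) (s≤s k<j) = at-beyond v (suc j) k<j

at-set-eq : ∀ {k} (v : Vec ℤ k) a x → 1 ≤ℕ a → a ≤ℕ k → at (set v a x) a ≡ x
at-set-eq (_ ∷ v) (suc zero) x _ _ = refl
at-set-eq (_ ∷ v) (suc (suc a)) x _ (s≤s a<k) = at-set-eq v (suc a) x (s≤s z≤n) a<k

at-set-neq : ∀ {k} (v : Vec ℤ k) a x j → j ≢ a → at (set v a x) j ≡ at v j
at-set-neq [] a x j _ = refl
at-set-neq (_ ∷ v) zero x j _ = refl
at-set-neq (_ ∷ v) (suc zero) x zero _ = refl
at-set-neq (_ ∷ v) (suc zero) x (suc zero) j≢a = ⊥-elim (j≢a refl)
at-set-neq (_ ∷ v) (suc zero) x (suc (suc j)) _ = refl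
at-set-neq (_ ∷ v) (suc (suc a)) x zero _ = refl
at-set-neq (_ ∷ v) (suc (suc a)) x (suc zero) _ = refl
at-set-neq (_ ∷ v) (suc (suc a)) x (suc (suc j)) j≢a =
  at-set-neq v (suc a) x (suc j) (j≢a ∘ cong suc)

at-set : ∀ {k} (v : Vec ℤ k) a x → 1 ≤ℕ a → a ≤ℕ k → at (set v a x) ≗ update (at v) a x
at-set v a x 1≤a a≤k j with j ≟ a
... | yes refl = at-set-eq v a x 1≤a a≤k
... | no  j≢a = at-set-neq v a x j j≢a

pos-beyond : ∀ {n} (c : Vec ℤ (n ∸ 1)) i → ¬ (i ≤ℕ n ∸ 1) → pos (at c i) ≡ 0
pos-beyond c i i≰ rewrite at-beyond c i (≰⇒> i≰) = refl

cubic⇒valid : ∀ n (c : Vec ℤ (n ∸ 1)) → CubicCoordinate n c → Valid n (at c)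
cubic⇒valid n c (tam , dual-tam , int) = record
  { pos-bound = bound
  ; neg-bound = λ i 1≤i i≤ → proj₁ (dual-tam (suc i) (s≤s z≤n) (in-range⇒< 1≤i i≤))
  ; pairs     = pair
  }
  where
  bound : ∀ i → 1 ≤ℕ i → i ≤ℕ n ∸ 1 → pos (at c i) + i ≤ℕ n
  bound i 1≤i i≤ = subst (pos (at c i) + i ≤ℕ_) (m∸n+n≡m i≤n)
                     (+-monoˡ-≤ i (proj₁ (tam i 1≤i i≤n)))
    where i≤n = <⇒≤ (in-range⇒< 1≤i i≤)
  pair : ∀ a d → 1 ≤ℕ a → 1 ≤ℕ d → a + d ≤ℕ n ∸ 1 → Compatible (at c a) (at c (a + d)) d
  pair a d 1≤a 1≤d b≤ = record
    { tamari   = λ d≤u → subst (pos (at c (a + d)) + d ≤ℕ_) (m∸n+n≡m d≤u)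
                           (+-monoˡ-≤ d (proj₂ (tam a 1≤a a≤n) d d≤u))
    ; dual     = λ d≤v → subst (λ k → neg (at c (k ∸ 1)) + d ≤ℕ neg (at c (a + d)))
                           (m+n∸n≡m (suc a) d)
                           (proj₂ (dual-tam (suc (a + d)) (s≤s z≤n) b<n) d d≤v)
    ; interval = λ d<u → ≤-pred (subst (neg (at c (a + d)) <ℕ_) distance
                           (int a (suc (a + d)) 1≤a (s≤s (m≤m+n a d)) b<n
                             (subst (_≤ℕ pos (at c a)) (sym distance) d<u)))
    }
    where
    b<n : suc (a + d) ≤ℕ n
    b<n = in-range⇒< (≤-trans 1≤a (m≤m+n a d)) b≤
    distance : suc (a + d) ∸ a ≡ suc d
    distance = trans (+-∸-assoc 1 (m≤m+n a d)) (cong suc (m+n∸m≡n a d))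
    a≤n : a ≤ℕ n
    a≤n = ≤-trans (m≤m+n a d) (<⇒≤ b<n)

valid⇒tamari : ∀ n (c : Vec ℤ (n ∸ 1)) → Valid n (at c) → TamariDiagram n (uOf c)
valid⇒tamari n c V i 1≤i _ = bound , descent
  where
  bound : pos (at c i) ≤ℕ n ∸ i
  bound with i ≤? n ∸ 1
  ... | yes i≤ = m+n≤o⇒m≤o∸n (pos (at c i)) (pos-bound V i 1≤i i≤)
  ... | no  i≰ = subst (_≤ℕ n ∸ i) (sym (pos-beyond {n} c i i≰)) z≤n
  -- Descents stay inside the tuple; beyond its end the entries are 0.
  descent : ∀ j → j ≤ℕ pos (at c i) → pos (at c (i + j)) ≤ℕ pos (at c i) ∸ j
  descent zero _ rewrite +-identityʳ i = ≤-refl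
  descent (suc j) j<u with i + suc j ≤? n ∸ 1
  ... | yes b≤ = m+n≤o⇒m≤o∸n _ (tamari (pairs V i (suc j) 1≤i (s≤s z≤n) b≤) j<u)
  ... | no  b≰ = subst (_≤ℕ pos (at c i) ∸ suc j) (sym (pos-beyond {n} c (i + suc j) b≰)) z≤n

-- The dual Tamari clause, including the position 0 whose entry reads as 0.
dual-descent : ∀ n (c : Vec ℤ (n ∸ 1)) → Valid n (at c) → ∀ e j i → e + j ≡ i →
  1 ≤ℕ j → i ≤ℕ n ∸ 1 → j ≤ℕ neg (at c i) → neg (at c e) + j ≤ℕ neg (at c i)
dual-descent n c V zero j .j refl _ _ j≤v rewrite at-zero c = j≤v
dual-descent n c V (suc e) j ._ refl 1≤j i≤ j≤v = dual (pairs V (suc e) j (s≤s z≤n) 1≤j i≤) j≤v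

neg-bound₀ : ∀ n (c : Vec ℤ (n ∸ 1)) → Valid n (at c) → ∀ i → i <ℕ n → neg (at c i) ≤ℕ i
neg-bound₀ n c V zero _ rewrite at-zero c = z≤n
neg-bound₀ n c V (suc i) i<n = neg-bound V (suc i) (s≤s z≤n) (<⇒≤pred i<n)

valid⇒dual : ∀ n (c : Vec ℤ (n ∸ 1)) → Valid n (at c) → DualTamariDiagram n (vOf c)
valid⇒dual n c V (suc i) _ i<n = neg-bound₀ n c V i i<n , descent
  where
  descent : ∀ j → j ≤ℕ neg (at c i) → neg (at c (suc i ∸ j ∸ 1)) + j ≤ℕ neg (at c i)
  descent zero _ = ≤-reflexive (+-identityʳ _)
  descent j@(suc _) j≤v =
    subst (λ k → neg (at c (k ∸ 1)) + j ≤ℕ neg (at c i)) (sym (+-∸-assoc 1 j≤i))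
      (dual-descent n c V (i ∸ j) j i (m∸n+n≡m j≤i) (s≤s z≤n) (<⇒≤pred i<n) j≤v)
    where j≤i = ≤-trans j≤v (neg-bound₀ n c V i i<n)

interval-step : ∀ {n f} → Valid n f → ∀ i d → 1 ≤ℕ i → i + d ≤ℕ n ∸ 1 →
  suc d ≤ℕ pos (f i) → neg (f (i + d)) ≤ℕ d
interval-step {f = f} V i zero _ _ 1≤u rewrite +-identityʳ i | pos⇒neg≡0 (f i) 1≤u = z≤n
interval-step V i (suc d) 1≤i b≤ d<u = interval (pairs V i (suc d) 1≤i (s≤s z≤n) b≤) d<u

valid⇒interval : ∀ n (c : Vec ℤ (n ∸ 1)) → Valid n (at c) →
  (i j : ℕ) → 1 ≤ℕ i → i <ℕ j → j ≤ℕ n → j ∸ i ≤ℕ uOf c i → vOf c j <ℕ j ∸ i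
valid⇒interval n c V i (suc j) 1≤i (s≤s i≤j) j<n h =
  subst₂ (λ k l → neg (at c k) <ℕ l) (m+[n∸m]≡n i≤j) (sym (+-∸-assoc 1 i≤j))
    (s≤s (interval-step V i (j ∸ i) 1≤i
           (subst (_≤ℕ n ∸ 1) (sym (m+[n∸m]≡n i≤j)) (<⇒≤pred j<n))
           (subst (_≤ℕ pos (at c i)) (+-∸-assoc 1 i≤j) h)))

valid⇒cubic : ∀ n (c : Vec ℤ (n ∸ 1)) → Valid n (at c) → CubicCoordinate n c
valid⇒cubic n c V = valid⇒tamari n c V , valid⇒dual n c V , valid⇒interval n c V

Valid-update : ∀ {n f a y} → Valid n f → 1 ≤ℕ a → pos y + a ≤ℕ n → neg y ≤ℕ a →
  (∀ a' d → 1 ≤ℕ a' → 1 ≤ℕ d → a' + d ≡ a → Compatible (f a') y d) →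
  (∀ d → 1 ≤ℕ d → a + d ≤ℕ n ∸ 1 → Compatible y (f (a + d)) d) →
  Valid n (update f a y)
Valid-update {n} {f} {a} {y} V 1≤a pos≤ neg≤ left right = record
  { pos-bound = λ i 1≤i i≤ →
      entry (λ z → pos z + i ≤ℕ n) i (λ { refl → pos≤ }) (pos-bound V i 1≤i i≤)
  ; neg-bound = λ i 1≤i i≤ →
      entry (λ z → neg z ≤ℕ i) i (λ { refl → neg≤ }) (neg-bound V i 1≤i i≤)
  ; pairs     = pair
  }
  where
  g = update f a y
  entry : (P : ℤ → Set) → ∀ i → (i ≡ a → P y) → P (f i) → P (g i)
  entry P i new old = by-cases (i ≟ a)
    where
    by-cases : Dec (i ≡ a) → P (g i)
    by-cases (yes refl) = subst P (sym (update-eq f a y)) (new refl)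
    by-cases (no i≢a) = subst P (sym (update-neq f a y i i≢a)) old
  pair : ∀ b d → 1 ≤ℕ b → 1 ≤ℕ d → b + d ≤ℕ n ∸ 1 → Compatible (g b) (g (b + d)) d
  pair b d 1≤b 1≤d b+d≤ = by-cases (b ≟ a) (b + d ≟ a)
    where
    by-cases : Dec (b ≡ a) → Dec (b + d ≡ a) → Compatible (g b) (g (b + d)) d
    by-cases (yes refl) _ = compatible-≡ (update-eq f b y)
      (update-neq f b y (b + d) (a+d≢a b d 1≤d)) (right d 1≤d b+d≤)
    by-cases (no b≢a) (yes b+d≡a) = compatible-≡ (update-neq f a y b b≢a)
      (trans (cong g b+d≡a) (update-eq f a y)) (left b d 1≤b 1≤d b+d≡a)
    by-cases (no b≢a) (no b+d≢a) = compatible-≡ (update-neq f a y b b≢a)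
      (update-neq f a y (b + d) b+d≢a) (pairs V b d 1≤b 1≤d b+d≤)

Valid-reset : ∀ {n f a} → Valid n f → 1 ≤ℕ a → a ≤ℕ n ∸ 1 → Valid n (update f a (+ 0))
Valid-reset V 1≤a a≤ = Valid-update V 1≤a (<⇒≤ (in-range⇒< 1≤a a≤)) z≤n
  (λ a' d _ 1≤d _ → compatible-nonneg-right 1≤d (λ h → h))
  (λ d 1≤d _ → compatible-nonneg-left (λ d≤0 → ⊥-elim (n≮0 (≤-trans 1≤d d≤0))) (λ ()))

-- What the step ↑_a of the chain from m = c^m to M = c^M says, given that the
-- tuples before and after it are the splices of m and M at a+1 and at a.
record StepFacts (n : ℕ) (m M : ℕ → ℤ) (a : ℕ) : Set where
  field
    raises  : m a < M a
    before  : Valid n (splice m M (suc a))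
    after   : Valid n (splice m M a)
    minimal : ∀ y → m a < y → y < M a → ¬ Valid n (update (splice m M (suc a)) a y)
open StepFacts

StepFacts-cong : ∀ {n m m' M a} → (∀ j → j ≤ℕ a → m j ≡ m' j) →
  StepFacts n m M a → StepFacts n m' M a
StepFacts-cong {M = M} {a} agree S = record
  { raises  = subst (_< M a) (agree a ≤-refl) (raises S)
  ; before  = Valid-cong before≗ (before S)
  ; after   = Valid-cong (splice-cong M a (λ j j<a → agree j (<⇒≤ j<a))) (after S)
  ; minimal = λ y m'<y y<M V → minimal S y (subst (_< y) (sym (agree a ≤-refl)) m'<y) y<M
                (Valid-cong (update-cong a y (sym ∘ before≗)) V)
  }
  where
  before≗ = splice-cong M (suc a) (λ j j<a+1 → agree j (≤-pred j<a+1))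

up-unchanged : ∀ {n a e e'} → Up n a e e' → ∀ j → j ≢ a → at e' j ≡ at e j
up-unchanged {a = a} {e} (x , refl , _) j j≢a = at-set-neq e a x j j≢a

up-step-facts : ∀ n a (e e' d : Vec ℤ (n ∸ 1)) → 1 ≤ℕ a → a ≤ℕ n ∸ 1 →
  CubicCoordinate n e → Up n a e e' → (∀ j → a ≤ℕ j → at d j ≡ at e' j) →
  StepFacts n (at e) (at d) a
up-step-facts n a e e' d 1≤a a≤ e-cubic up@(x , refl , e'-cubic , e<x , no-smaller) agree = record
  { raises  = subst (at e a <_) (sym d-at-a) e<x
  ; before  = Valid-cong before≗ (cubic⇒valid n e e-cubic)
  ; after   = Valid-cong after≗ (cubic⇒valid n e' e'-cubic)
  ; minimal = λ y e<y y<d V → no-smaller y e<y (subst (y <_) d-at-a y<d)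
                (valid⇒cubic n (set e a y)
                  (Valid-cong (λ j → trans (update-cong a y (sym ∘ before≗) j)
                                           (sym (at-set e a y 1≤a a≤ j))) V))
  }
  where
  d-at-a : at d a ≡ x
  d-at-a = trans (agree a ≤-refl) (at-set-eq e a x 1≤a a≤)
  before≗ : at e ≗ splice (at e) (at d) (suc a)
  before≗ j with j <? suc a
  ... | yes _ = refl
  ... | no  j≰a = sym (trans (agree j (<⇒≤ a<j)) (up-unchanged up j (<⇒≢ a<j ∘ sym)))
    where a<j = ≮⇒≥ j≰a
  after≗ : at e' ≗ splice (at e) (at d) a
  after≗ j with j <? a
  ... | yes j<a = up-unchanged up j (<⇒≢ j<a)
  ... | no  j≮a = sym (agree j (≮⇒≥ j≮a))

chain-facts : ∀ n k (e d : Vec ℤ (n ∸ 1)) → Ups n k e d → k ≤ℕ n ∸ 1 → CubicCoordinate n e →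
  (∀ a → 1 ≤ℕ a → a ≤ℕ k → StepFacts n (at e) (at d) a) × (∀ j → k <ℕ j → at d j ≡ at e j)
chain-facts n zero e .e refl _ _ = (λ { a (s≤s _) () }) , (λ _ _ → refl)
chain-facts n (suc k) e d (e' , up , rest) k<n e-cubic = facts , agree
  where
  IH = chain-facts n k e' d rest (<⇒≤ k<n) (proj₁ (proj₂ (proj₂ up)))
  unchanged = up-unchanged up
  agree : ∀ j → suc k <ℕ j → at d j ≡ at e j
  agree j k+1<j = trans (proj₂ IH j (<⇒≤ k+1<j)) (unchanged j (<⇒≢ k+1<j ∘ sym))
  facts : ∀ a → 1 ≤ℕ a → a ≤ℕ suc k → StepFacts n (at e) (at d) a
  facts a 1≤a a≤k+1 with m≤n⇒m<n∨m≡n a≤k+1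
  ... | inj₁ (s≤s a≤k) = StepFacts-cong (λ j j≤a → unchanged j (<⇒≢ (s≤s (≤-trans j≤a a≤k))))
                           (proj₁ IH a 1≤a a≤k)
  ... | inj₂ refl = up-step-facts n (suc k) e e' d 1≤a k<n e-cubic up (proj₂ IH)

module MixedPairs (n : ℕ) (m M : ℕ → ℤ) (valid-low : Valid n m) (valid-high : Valid n M)
  (step : ∀ a → 1 ≤ℕ a → a ≤ℕ n ∸ 1 → StepFacts n m M a)
  (raisable : ∀ a → 1 ≤ℕ a → a ≤ℕ n ∸ 1 → Σ ℤ λ x → m a < x × Valid n (update m a x)) where

  -- A negative entry of c^m stays non-positive in c^M: otherwise 0 would be an
  -- admissible intermediate value, since resetting an entry to 0 keeps validity.
  negative-stays-nonpositive : ∀ b → 1 ≤ℕ b → b ≤ℕ n ∸ 1 → 1 ≤ℕ neg (m b) → pos (M b) ≡ 0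
  negative-stays-nonpositive b 1≤b b≤ 1≤neg with pos (M b) in pos≡
  ... | zero = refl
  ... | suc _ = ⊥-elim (minimal S (+ 0) (negative 1≤neg)
                  (positive (subst (1 ≤ℕ_) (sym pos≡) (s≤s z≤n))) (Valid-reset (before S) 1≤b b≤))
    where S = step b 1≤b b≤

  HighLowInterval : ℕ → Set
  HighLowInterval d = ∀ a → 1 ≤ℕ a → 1 ≤ℕ d → a + d ≤ℕ n ∸ 1 →
    suc d ≤ℕ pos (M a) → neg (m (a + d)) ≤ℕ d

  -- If the clause fails at a with distance d (suc d ≤ neg c^m_{a+d}) but holds at
  -- smaller distances, then every entry c^M_{a+d'}, 0 < d' ≤ d, ends before a + d.
  -- For d' = d this is negative-stays-nonpositive, for d' < d the clause at d - d'.
  high-entries-short : ∀ d → (∀ {e} → e <ℕ d → HighLowInterval e) → ∀ a → 1 ≤ℕ a →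
    a + d ≤ℕ n ∸ 1 → suc d ≤ℕ neg (m (a + d)) →
    ∀ d' → 1 ≤ℕ d' → d' ≤ℕ d → pos (M (a + d')) + d' ≤ℕ d
  high-entries-short d IH a 1≤a b≤ d<neg d' 1≤d' d'≤d with m≤n⇒m<n∨m≡n d'≤d
  ... | inj₂ refl rewrite negative-stays-nonpositive (a + d) (≤-trans 1≤a (m≤m+n a d)) b≤
                            (≤-trans (s≤s z≤n) d<neg) = ≤-refl
  ... | inj₁ d'<d with pos (M (a + d')) + d' ≤? d
  ...   | yes short = short
  ...   | no  long = ⊥-elim (<⇒≱ d<neg
                        (≤-trans (subst (λ k → neg (m k) ≤ℕ e) same-end interval-e) (m∸n≤m d d')))
    where
    e = d ∸ d'
    same-end : a + d' + e ≡ a + d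
    same-end = trans (+-assoc a d' e) (cong (λ k → a + k) (m+[n∸m]≡n d'≤d))
    e<u : suc e ≤ℕ pos (M (a + d'))
    e<u = +-cancelʳ-≤ d' (suc e) _
            (subst (_<ℕ pos (M (a + d')) + d') (sym (m∸n+n≡m d'≤d)) (≰⇒> long))
    interval-e : neg (m (a + d' + e)) ≤ℕ e
    interval-e = IH (∸-monoʳ-< 1≤d' d'≤d) (a + d') (≤-trans 1≤a (m≤m+n a d'))
                   (m<n⇒0<n∸m d'<d) (subst (_≤ℕ n ∸ 1) (sym same-end) b≤) e<u

  -- The value x raised at a by minimal-cellularity stays compatible with
  -- c^m_{a+d}; if the interval clause fails there, this forces x ≤ d.
  raised-below : ∀ a d → 1 ≤ℕ a → 1 ≤ℕ d → a + d ≤ℕ n ∸ 1 →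
    suc d ≤ℕ neg (m (a + d)) → m a < + d
  raised-below a d 1≤a 1≤d b≤ d<neg with raisable a 1≤a (≤-trans (m≤m+n a d) b≤)
  ... | x , m<x , raised-valid = <-below-pos d m<x x≤d
    where
    raised : Compatible x (m (a + d)) d
    raised = compatible-≡ (sym (update-eq m a x))
      (sym (update-neq m a x (a + d) (a+d≢a a d 1≤d))) (pairs raised-valid a d 1≤a 1≤d b≤)
    x≤d : pos x ≤ℕ d
    x≤d with suc d ≤? pos x
    ... | no  small = ≤-pred (≰⇒> small)
    ... | yes big = ⊥-elim (<⇒≱ d<neg (interval raised big))

  distance-admissible : ∀ d → (∀ {e} → e <ℕ d → HighLowInterval e) →
    ∀ a → 1 ≤ℕ a → 1 ≤ℕ d → a + d ≤ℕ n ∸ 1 → suc d ≤ℕ pos (M a) →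
    suc d ≤ℕ neg (m (a + d)) → Valid n (update (splice m M (suc a)) a (+ d))
  distance-admissible d IH a 1≤a 1≤d b≤ d<u d<neg =
    Valid-update (before S) 1≤a pos≤ (subst (_≤ℕ a) (sym (neg-+ d)) z≤n) left right
    where
    S = step a 1≤a (≤-trans (m≤m+n a d) b≤)
    f = splice m M (suc a)
    pos≤ : pos (+ d) + a ≤ℕ n
    pos≤ = subst (λ k → k + a ≤ℕ n) (sym (pos-+ d))
             (≤-trans (≤-reflexive (+-comm d a)) (≤-trans b≤ (m∸n≤m n 1)))
    -- Entries to the left: c^m_{a'} already reaches past c^M_a, hence past d.
    left : ∀ a' d' → 1 ≤ℕ a' → 1 ≤ℕ d' → a' + d' ≡ a → Compatible (f a') (+ d) d'
    left a' d' 1≤a' 1≤d' refl =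
      compatible-≡ (splice-< m M (suc a) a' (s≤s (m≤m+n a' d'))) refl
        (compatible-nonneg-right 1≤d'
          (λ h → ≤-trans (+-monoˡ-≤ d' (<⇒≤ d<u)) (tamari low-high h)))
      where
      low-high = compatible-≡ (sym (splice-< m M (a' + d') a' (m<m+n a' 1≤d')))
        (sym (splice-≥ m M (a' + d') (a' + d') ≤-refl))
        (pairs (after S) a' d' 1≤a' 1≤d' (≤-trans (m≤m+n (a' + d') d) b≤))
    -- Entries to the right: c^M_{a+d'} ends before a + d, and the interval clause
    -- is inherited from the pair (c^M_a, c^M_{a+d'}) since d < pos c^M_a.
    right : ∀ d' → 1 ≤ℕ d' → a + d' ≤ℕ n ∸ 1 → Compatible (+ d) (f (a + d')) d'
    right d' 1≤d' b'≤ =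
      compatible-≡ refl (splice-≥ m M (suc a) (a + d') (m<m+n a 1≤d'))
        (compatible-nonneg-left (high-entries-short d IH a 1≤a b≤ d<neg d' 1≤d')
          (λ d'<d → interval high-high (≤-trans d'<d (<⇒≤ d<u))))
      where
      high-high = compatible-≡ (sym (splice-≥ m M a a ≤-refl))
        (sym (splice-≥ m M a (a + d') (m≤m+n a d'))) (pairs (after S) a d' 1≤a 1≤d' b'≤)

  -- The interval clause for (c^M_a, c^m_{a+d}), by strong induction on d: a failure
  -- would make d an admissible value strictly between c^m_a and c^M_a.
  high-low-interval : ∀ d → HighLowInterval d
  high-low-interval = <-rec HighLowInterval by-smaller
    where
    by-smaller : ∀ d → (∀ {e} → e <ℕ d → HighLowInterval e) → HighLowInterval d
    by-smaller d IH a 1≤a 1≤d b≤ d<u with suc d ≤? neg (m (a + d))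
    ... | no  holds = ≤-pred (≰⇒> holds)
    ... | yes d<neg = ⊥-elim (minimal (step a 1≤a (≤-trans (m≤m+n a d) b≤)) (+ d)
                        (raised-below a d 1≤a 1≤d b≤ d<neg) (pos-above d d<u)
                        (distance-admissible d IH a 1≤a 1≤d b≤ d<u d<neg))

  -- (c^m_a, c^M_{a+d}) is a pair of the splice at a + d.
  low-high : ∀ a d → 1 ≤ℕ a → 1 ≤ℕ d → a + d ≤ℕ n ∸ 1 → Compatible (m a) (M (a + d)) d
  low-high a d 1≤a 1≤d b≤ = compatible-≡ (sym (splice-< m M (a + d) a (m<m+n a 1≤d)))
    (sym (splice-≥ m M (a + d) (a + d) ≤-refl))
    (pairs (after (step (a + d) 1≤b b≤)) a d 1≤a 1≤d b≤)
    where 1≤b = ≤-trans 1≤a (m≤m+n a d)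

  -- (c^M_a, c^m_{a+d}): the Tamari clause is inherited from c^M and the dual one
  -- from c^m, as m < M entrywise; the interval clause is high-low-interval.
  high-low : ∀ a d → 1 ≤ℕ a → 1 ≤ℕ d → a + d ≤ℕ n ∸ 1 → Compatible (M a) (m (a + d)) d
  high-low a d 1≤a 1≤d b≤ = record
    { tamari   = λ h → ≤-trans (+-monoˡ-≤ d (pos-mono (raises (step (a + d) 1≤b b≤))))
                         (tamari (pairs valid-high a d 1≤a 1≤d b≤) h)
    ; dual     = λ h → ≤-trans (+-monoˡ-≤ d (neg-anti (raises (step a 1≤a a≤))))
                         (dual (pairs valid-low a d 1≤a 1≤d b≤) h)
    ; interval = high-low-interval d a 1≤a 1≤d b≤
    }
    where
    1≤b = ≤-trans 1≤a (m≤m+n a d)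
    a≤ = ≤-trans (m≤m+n a d) b≤

valid-mixture : ∀ {n m M} → Valid n m → Valid n M →
  (∀ a d → 1 ≤ℕ a → 1 ≤ℕ d → a + d ≤ℕ n ∸ 1 → Compatible (m a) (M (a + d)) d) →
  (∀ a d → 1 ≤ℕ a → 1 ≤ℕ d → a + d ≤ℕ n ∸ 1 → Compatible (M a) (m (a + d)) d) →
  (f : ℕ → ℤ) → (∀ i → 1 ≤ℕ i → i ≤ℕ n ∸ 1 → (f i ≡ m i) ⊎ (f i ≡ M i)) → Valid n f
valid-mixture {n} {m} {M} Vm VM low-high high-low f choice = record
  { pos-bound = λ i p q → entry (λ z → pos z + i ≤ℕ n) i p q (pos-bound Vm i p q) (pos-bound VM i p q)
  ; neg-bound = λ i p q → entry (λ z → neg z ≤ℕ i) i p q (neg-bound Vm i p q) (neg-bound VM i p q)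
  ; pairs     = pair
  }
  where
  entry : (P : ℤ → Set) → ∀ i → 1 ≤ℕ i → i ≤ℕ n ∸ 1 → P (m i) → P (M i) → P (f i)
  entry P i p q Pm PM = [ (λ e → subst P (sym e) Pm) , (λ e → subst P (sym e) PM) ] (choice i p q)
  pair : ∀ a d → 1 ≤ℕ a → 1 ≤ℕ d → a + d ≤ℕ n ∸ 1 → Compatible (f a) (f (a + d)) d
  pair a d 1≤a 1≤d b≤
    with choice a 1≤a (≤-trans (m≤m+n a d) b≤) | choice (a + d) (≤-trans 1≤a (m≤m+n a d)) b≤
  ... | inj₁ ea | inj₁ eb = compatible-≡ ea eb (pairs Vm a d 1≤a 1≤d b≤)
  ... | inj₁ ea | inj₂ eb = compatible-≡ ea eb (low-high a d 1≤a 1≤d b≤)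
  ... | inj₂ ea | inj₁ eb = compatible-≡ ea eb (high-low a d 1≤a 1≤d b≤)
  ... | inj₂ ea | inj₂ eb = compatible-≡ ea eb (pairs VM a d 1≤a 1≤d b≤)

mainTheorem10 : (n : ℕ) → 2 ≤ℕ n → (cm cM : Vec ℤ (n ∸ 1)) → Cell n cm cM →
    (c : Vec ℤ (n ∸ 1)) →
    ((i : ℕ) → 1 ≤ℕ i → i ≤ℕ n ∸ 1 → (at c i ≡ at cm i) ⊎ (at c i ≡ at cM i)) →
    CubicCoordinate n c
mainTheorem10 n 2≤n cm cM ((cm-cubic , raisable-cubic) , chain) c c-mixed =
  valid⇒cubic n c (valid-mixture valid-low valid-high low-high high-low (at c) c-mixed)
  where
  step = proj₁ (chain-facts n (n ∸ 1) cm cM chain ≤-refl cm-cubic)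
  valid-low = cubic⇒valid n cm cm-cubic
  -- c^M is the splice at 1, the tuple after the last step ↑_1.
  valid-high : Valid n (at cM)
  valid-high = Valid-cong (splice-at-1 (trans (at-zero cm) (sym (at-zero cM))))
                 (after (step 1 ≤-refl (<⇒≤pred 2≤n)))
  raisable : ∀ a → 1 ≤ℕ a → a ≤ℕ n ∸ 1 → Σ ℤ λ x → at cm a < x × Valid n (update (at cm) a x)
  raisable a 1≤a a≤ with raisable-cubic a 1≤a a≤
  ... | x , cm<x , cubic =
    x , cm<x , Valid-cong (at-set cm a x 1≤a a≤) (cubic⇒valid n (set cm a x) cubic)
  open MixedPairs n (at cm) (at cM) valid-low valid-high step raisable
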